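{- For each positive integer $k$, let $z_k$ be the supremum of $\dfrac{\sum_{j=1}^k \alpha_j}{f+\sum_{j=1}^k d_j}$ over all non-negative reals $\alpha_1,\dots,\alpha_k,d_1,\dots,d_k,f$ with $f+\sum_j d_j>0$ satisfying (i) $\alpha_j\le\alpha_{j+1}$ for all $1\le j<k$; (ii) $\sqrt{\alpha_j}\le\sqrt{\alpha_l}+\sqrt{d_j}+\sqrt{d_l}$ for all $1\le j,l\le k$; (iii) $\sum_{l=j}^{k}\max(\alpha_j-d_l,0)\le f$ for all $1\le j\le k$. Then $\sup_{k\ge1} z_k \ge 2.86$. -}

module Defs where

open import Data.Nat using (ℕ; zero; suc)
open import Data.Fin using (Fin; zero; suc; _≤?_; toℕ)
open import Relation.Binary.PropositionalEquality using (_≡_)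
open import Data.Bool using (if_then_else_)
open import Relation.Nullary using (does)
open import Data.Rational using (ℚ; 0ℚ; _+_; _-_; _*_; _⊔_; _/_)
open import Data.Integer using (+_)

Σ : ∀ {k} → (Fin k → ℚ) → ℚ
Σ {zero} g = 0ℚ
Σ {suc k} g = g zero + Σ (λ i → g (suc i))

Σ≥ : ∀ {k} → Fin k → (Fin k → ℚ) → ℚ
Σ≥ j g = Σ (λ l → if does (j ≤? l) then g l else 0ℚ)

sq : ℚ → ℚ
sq x = x * x

c286 : ℚ
c286 = (+ 143) / 50

-- Feasibility of a configuration, parametrised by the square roots
-- a j = √α_j and e j = √d_j  (so α_j = a_j², d_j = e_j²), with f.
record Feasible (k : ℕ) (a e : Fin k → ℚ) (f : ℚ) : Set where
  open Data.Rational using (_≤_; _<_)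
  field
    a-nonneg : ∀ j → 0ℚ ≤ a j
    e-nonneg : ∀ j → 0ℚ ≤ e j
    f-nonneg : 0ℚ ≤ f
    denom-pos : 0ℚ < f + Σ (λ j → sq (e j))
    cond-i : ∀ j l → toℕ l ≡ suc (toℕ j) → sq (a j) ≤ sq (a l)
    cond-ii : ∀ j l → a j ≤ a l + e j + e l
    cond-iii : ∀ j → Σ≥ j (λ l → (sq (a j) - sq (e l)) ⊔ 0ℚ) ≤ f

{-# OPTIONS --safe #-}
module Submission where

-- Put e_j = |a_j - c| for a centre c.  Then condition (ii) is the triangle inequality
-- |a_j - a_l| ≤ |a_j - c| + |a_l - c|, and (iii) holds once f is the largest of the
-- suffix excesses Σ_{l ≥ j} (a_j² - e_l²)⁺.  It remains to exhibit one increasing profile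
-- a_1 ≤ … ≤ a_k for which the resulting ratio reaches 2.86; being homogeneous, the ratio
-- can be evaluated on natural numbers.

open import Defs
open import Data.Nat using (ℕ; suc)
open import Data.Fin using (Fin)
open import Data.Product using (Σ-syntax; _×_)
open import Data.Rational using (ℚ; 0ℚ; _<_; _+_; _-_; _*_)

open import Data.Bool using (if_then_else_)
open import Data.Fin using (zero; suc; toℕ)
import Data.Integer as ℤ
import Data.Integer.Properties as ℤ
import Data.Nat as ℕ
open import Data.Nat.Coprimality using (1-coprimeTo)
import Data.Nat.Coprimality as Coprime
import Data.Nat.Properties as ℕ
open import Data.Product using (_,_)
open import Data.Sum using (inj₁; inj₂)
open import Data.Rational using (mkℚ; _≤_; _⊔_; -_; positive)
import Data.Rational as ℚ
import Data.Rational.Properties as ℚ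
open import Data.Vec using (Vec; []; _∷_; lookup; map; sum; replicate; _++_)
open import Data.Vec.Properties using (lookup-map)
open import Data.Vec.Relation.Unary.Linked using (Linked; linked?)
open import Data.Vec.Relation.Unary.Linked.Properties using (lookup⁺)
open import Function using (_∘_)
open import Relation.Nullary.Decidable using (toWitness)
open import Relation.Binary.PropositionalEquality
  using (_≡_; refl; cong; cong₂; subst; subst₂; module ≡-Reasoning)
import Relation.Binary.PropositionalEquality as ≡

fromℕ : ℕ → ℚ
fromℕ n = mkℚ (ℤ.+ n) 0 (Coprime.sym (1-coprimeTo n))

fromℕ-+ : ∀ m n → fromℕ (m ℕ.+ n) ≡ fromℕ m + fromℕ n
fromℕ-+ m n = ≡.sym (begin
  fromℕ m + fromℕ n        ≡⟨ cong (ℚ._/ 1) (cong₂ ℤ._+_ (ℤ.*-identityʳ (ℤ.+ m)) (ℤ.*-identityʳ (ℤ.+ n))) ⟩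
  (ℤ.+ m ℤ.+ ℤ.+ n) ℚ./ 1  ≡⟨ ℚ.normalize-coprime (Coprime.sym (1-coprimeTo (m ℕ.+ n))) ⟩
  fromℕ (m ℕ.+ n)          ∎)
  where open ≡-Reasoning

fromℕ-* : ∀ m n → fromℕ (m ℕ.* n) ≡ fromℕ m * fromℕ n
fromℕ-* m n = ≡.sym (begin
  fromℕ m * fromℕ n        ≡⟨ cong (ℚ._/ 1) (≡.sym (ℤ.pos-* m n)) ⟩
  ℤ.+ (m ℕ.* n) ℚ./ 1      ≡⟨ ℚ.normalize-coprime (Coprime.sym (1-coprimeTo (m ℕ.* n))) ⟩
  fromℕ (m ℕ.* n)          ∎)
  where open ≡-Reasoning

fromℕ-mono-≤ : ∀ {m n} → m ℕ.≤ n → fromℕ m ≤ fromℕ n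
fromℕ-mono-≤ {m} {n} m≤n = ℚ.*≤* (subst₂ ℤ._≤_
  (≡.sym (ℤ.*-identityʳ (ℤ.+ m))) (≡.sym (ℤ.*-identityʳ (ℤ.+ n))) (ℤ.+≤+ m≤n))

fromℕ-mono-< : ∀ {m n} → m ℕ.< n → fromℕ m < fromℕ n
fromℕ-mono-< {m} {n} m<n = ℚ.*<* (subst₂ ℤ._<_
  (≡.sym (ℤ.*-identityʳ (ℤ.+ m))) (≡.sym (ℤ.*-identityʳ (ℤ.+ n))) (ℤ.+<+ m<n))

0≤fromℕ : ∀ n → 0ℚ ≤ fromℕ n
0≤fromℕ n = fromℕ-mono-≤ ℕ.z≤n

fromℕ-∸ : ∀ m n → fromℕ (m ℕ.∸ n) ≡ (fromℕ m - fromℕ n) ⊔ 0ℚ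
fromℕ-∸ m n with ℕ.≤-total n m
... | inj₁ n≤m = ≡.sym (≡.trans (ℚ.p≥q⇒p⊔q≡p (subst (0ℚ ≤_) (≡.sym difference) (0≤fromℕ _)))
                                difference)
  where
  open ≡-Reasoning
  difference : fromℕ m - fromℕ n ≡ fromℕ (m ℕ.∸ n)
  difference = begin
    fromℕ m - fromℕ n                      ≡⟨ cong (λ k → fromℕ k - fromℕ n) (≡.sym (ℕ.m∸n+n≡m n≤m)) ⟩
    fromℕ (m ℕ.∸ n ℕ.+ n) - fromℕ n        ≡⟨ cong (_- fromℕ n) (fromℕ-+ (m ℕ.∸ n) n) ⟩
    fromℕ (m ℕ.∸ n) + fromℕ n - fromℕ n    ≡⟨ ℚ.+-assoc (fromℕ (m ℕ.∸ n)) (fromℕ n) (- fromℕ n) ⟩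
    fromℕ (m ℕ.∸ n) + (fromℕ n - fromℕ n)  ≡⟨ cong (fromℕ (m ℕ.∸ n) +_) (ℚ.+-inverseʳ (fromℕ n)) ⟩
    fromℕ (m ℕ.∸ n) + 0ℚ                   ≡⟨ ℚ.+-identityʳ (fromℕ (m ℕ.∸ n)) ⟩
    fromℕ (m ℕ.∸ n)                        ∎
... | inj₂ m≤n = begin
  fromℕ (m ℕ.∸ n)           ≡⟨ cong fromℕ (ℕ.m≤n⇒m∸n≡0 m≤n) ⟩
  0ℚ                        ≡⟨ ℚ.p≤q⇒p⊔q≡q nonpositive ⟨
  (fromℕ m - fromℕ n) ⊔ 0ℚ  ∎
  where
  open ≡-Reasoning
  nonpositive : fromℕ m - fromℕ n ≤ 0ℚ
  nonpositive = subst (fromℕ m - fromℕ n ≤_) (ℚ.+-inverseʳ (fromℕ m))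
    (ℚ.+-monoʳ-≤ (fromℕ m) (ℚ.neg-antimono-≤ (fromℕ-mono-≤ m≤n)))

sq-fromℕ : ∀ x → sq (fromℕ x) ≡ fromℕ (x ℕ.* x)
sq-fromℕ x = ≡.sym (fromℕ-* x x)

squareExcess : ℕ → ℕ → ℕ
squareExcess x y = x ℕ.* x ℕ.∸ y ℕ.* y

fromℕ-squareExcess : ∀ x y → fromℕ (squareExcess x y) ≡ (sq (fromℕ x) - sq (fromℕ y)) ⊔ 0ℚ
fromℕ-squareExcess x y = ≡.trans (fromℕ-∸ (x ℕ.* x) (y ℕ.* y))
  (cong₂ (λ p q → (p - q) ⊔ 0ℚ) (fromℕ-* x x) (fromℕ-* y y))

Σ-cong : ∀ {k} {g h : Fin k → ℚ} → (∀ i → g i ≡ h i) → Σ g ≡ Σ h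
Σ-cong {ℕ.zero} g≗h = refl
Σ-cong {suc k}  g≗h = cong₂ _+_ (g≗h zero) (Σ-cong (g≗h ∘ suc))

Σ-fromℕ : ∀ {k} (g : ℕ → ℕ) (xs : Vec ℕ k) →
          Σ (λ i → fromℕ (g (lookup xs i))) ≡ fromℕ (sum (map g xs))
Σ-fromℕ g []       = refl
Σ-fromℕ g (x ∷ xs) = ≡.trans (cong (fromℕ (g x) +_) (Σ-fromℕ g xs))
                             (≡.sym (fromℕ-+ (g x) (sum (map g xs))))

Σ-sq-fromℕ : ∀ {k} (xs : Vec ℕ k) →
             Σ (λ i → sq (fromℕ (lookup xs i))) ≡ fromℕ (sum (map (λ x → x ℕ.* x) xs))
Σ-sq-fromℕ xs = ≡.trans (Σ-cong (sq-fromℕ ∘ lookup xs)) (Σ-fromℕ (λ x → x ℕ.* x) xs)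

Σ≥-suc : ∀ {k} (j : Fin k) (g : Fin (suc k) → ℚ) → Σ≥ (suc j) g ≡ Σ≥ j (λ l → g (suc l))
Σ≥-suc j g = ≡.trans (ℚ.+-identityˡ _)
  (Σ-cong (λ l → cong (λ b → if b then g (suc l) else 0ℚ) (suc-≤ᵇ-suc (toℕ j) (toℕ l))))
  where
  suc-≤ᵇ-suc : ∀ m n → (suc m ℕ.≤ᵇ suc n) ≡ (m ℕ.≤ᵇ n)
  suc-≤ᵇ-suc ℕ.zero  n = refl
  suc-≤ᵇ-suc (suc m) n = refl

-- The maximum is taken with _⊔′_, which compares via the builtin _<ᵇ_: the unary
-- recursion of _⊔_ would be far too slow when this is evaluated on the certificate below.
worstSuffixExcess : ∀ {k} → Vec ℕ k → Vec ℕ k → ℕ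
worstSuffixExcess []       []           = 0
worstSuffixExcess (x ∷ xs) ds@(_ ∷ ds′) =
  sum (map (squareExcess x) ds) ℕ.⊔′ worstSuffixExcess xs ds′

m≤m⊔′n : ∀ m n → m ℕ.≤ m ℕ.⊔′ n
m≤m⊔′n m n = subst (m ℕ.≤_) (ℕ.⊔≡⊔′ m n) (ℕ.m≤m⊔n m n)

m≤n⊔′m : ∀ m n → m ℕ.≤ n ℕ.⊔′ m
m≤n⊔′m m n = subst (m ℕ.≤_) (ℕ.⊔≡⊔′ n m) (ℕ.m≤n⊔m n m)

suffixExcess≤worstSuffixExcess :
  ∀ {k} (xs ds : Vec ℕ k) (j : Fin k) →
  Σ≥ j (λ l → (sq (fromℕ (lookup xs j)) - sq (fromℕ (lookup ds l))) ⊔ 0ℚ)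
    ≤ fromℕ (worstSuffixExcess xs ds)
suffixExcess≤worstSuffixExcess (x ∷ xs) ds@(_ ∷ ds′) zero = begin
  Σ (λ l → (sq (fromℕ x) - sq (fromℕ (lookup ds l))) ⊔ 0ℚ)
    ≡⟨ Σ-cong (λ l → ≡.sym (fromℕ-squareExcess x (lookup ds l))) ⟩
  Σ (λ l → fromℕ (squareExcess x (lookup ds l)))
    ≡⟨ Σ-fromℕ (squareExcess x) ds ⟩
  fromℕ (sum (map (squareExcess x) ds))
    ≤⟨ fromℕ-mono-≤ (m≤m⊔′n _ (worstSuffixExcess xs ds′)) ⟩
  fromℕ (worstSuffixExcess (x ∷ xs) ds)
    ∎
  where open ℚ.≤-Reasoning
suffixExcess≤worstSuffixExcess (x ∷ xs) ds@(_ ∷ ds′) (suc j) = begin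
  Σ≥ (suc j) (λ l → (sq (fromℕ (lookup xs j)) - sq (fromℕ (lookup ds l))) ⊔ 0ℚ)
    ≡⟨ Σ≥-suc j (λ l → (sq (fromℕ (lookup xs j)) - sq (fromℕ (lookup ds l))) ⊔ 0ℚ) ⟩
  Σ≥ j (λ l → (sq (fromℕ (lookup xs j)) - sq (fromℕ (lookup ds′ l))) ⊔ 0ℚ)
    ≤⟨ suffixExcess≤worstSuffixExcess xs ds′ j ⟩
  fromℕ (worstSuffixExcess xs ds′)
    ≤⟨ fromℕ-mono-≤ (m≤n⊔′m _ (sum (map (squareExcess x) ds))) ⟩
  fromℕ (worstSuffixExcess (x ∷ xs) ds)
    ∎
  where open ℚ.≤-Reasoning

x≤y+∣x-c∣+∣y-c∣ : ∀ x y c → x ℕ.≤ y ℕ.+ ℕ.∣ x - c ∣ ℕ.+ ℕ.∣ y - c ∣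
x≤y+∣x-c∣+∣y-c∣ x y c = begin
  x                                    ≤⟨ ℕ.m≤n+∣m-n∣ x y ⟩
  y ℕ.+ ℕ.∣ x - y ∣                    ≤⟨ ℕ.+-monoʳ-≤ y (ℕ.∣-∣-triangle x c y) ⟩
  y ℕ.+ (ℕ.∣ x - c ∣ ℕ.+ ℕ.∣ c - y ∣)  ≡⟨ cong (λ d → y ℕ.+ (ℕ.∣ x - c ∣ ℕ.+ d)) (ℕ.∣-∣-comm c y) ⟩
  y ℕ.+ (ℕ.∣ x - c ∣ ℕ.+ ℕ.∣ y - c ∣)  ≡⟨ ℕ.+-assoc y _ _ ⟨
  y ℕ.+ ℕ.∣ x - c ∣ ℕ.+ ℕ.∣ y - c ∣    ∎
  where open ℕ.≤-Reasoning

module CentredConfiguration (c : ℕ) {k} (xs : Vec ℕ k) where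

  ds : Vec ℕ k
  ds = map (λ x → ℕ.∣ x - c ∣′) xs

  a e : Fin k → ℚ
  a = fromℕ ∘ lookup xs
  e = fromℕ ∘ lookup ds

  f : ℕ
  f = worstSuffixExcess xs ds

  numerator denominator : ℕ
  numerator   = sum (map (λ x → x ℕ.* x) xs)
  denominator = f ℕ.+ sum (map (λ x → x ℕ.* x) ds)

  Σ-sq-a : Σ (λ j → sq (a j)) ≡ fromℕ numerator
  Σ-sq-a = Σ-sq-fromℕ xs

  f+Σ-sq-e : fromℕ f + Σ (λ j → sq (e j)) ≡ fromℕ denominator
  f+Σ-sq-e = ≡.trans (cong (fromℕ f +_) (Σ-sq-fromℕ ds))
                     (≡.sym (fromℕ-+ f (sum (map (λ x → x ℕ.* x) ds))))

  lookup-ds : ∀ j → lookup ds j ≡ ℕ.∣ lookup xs j - c ∣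
  lookup-ds j = ≡.trans (lookup-map j _ xs) (≡.sym (ℕ.∣-∣≡∣-∣′ (lookup xs j) c))

  a≤a+e+e : ∀ j l → a j ≤ a l + e j + e l
  a≤a+e+e j l = subst (a j ≤_) fromℕ-a+e+e (fromℕ-mono-≤ (subst₂
    (λ u v → lookup xs j ℕ.≤ lookup xs l ℕ.+ u ℕ.+ v) (≡.sym (lookup-ds j)) (≡.sym (lookup-ds l))
    (x≤y+∣x-c∣+∣y-c∣ (lookup xs j) (lookup xs l) c)))
    where
    open ≡-Reasoning
    fromℕ-a+e+e : fromℕ (lookup xs l ℕ.+ lookup ds j ℕ.+ lookup ds l) ≡ a l + e j + e l
    fromℕ-a+e+e = begin
      fromℕ (lookup xs l ℕ.+ lookup ds j ℕ.+ lookup ds l)  ≡⟨ fromℕ-+ _ (lookup ds l) ⟩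
      fromℕ (lookup xs l ℕ.+ lookup ds j) + e l            ≡⟨ cong (_+ e l) (fromℕ-+ (lookup xs l) _) ⟩
      a l + e j + e l                                      ∎

  adjacent-sq-mono : Linked ℕ._≤_ xs → ∀ j l → toℕ l ≡ suc (toℕ j) → sq (a j) ≤ sq (a l)
  adjacent-sq-mono sorted j l l≡1+j =
    subst₂ _≤_ (≡.sym (sq-fromℕ (lookup xs j))) (≡.sym (sq-fromℕ (lookup xs l)))
      (fromℕ-mono-≤ (ℕ.*-mono-≤ xⱼ≤xₗ xⱼ≤xₗ))
    where
    xⱼ≤xₗ : lookup xs j ℕ.≤ lookup xs l
    xⱼ≤xₗ = lookup⁺ ℕ.≤-trans sorted (subst (toℕ j ℕ.<_) (≡.sym l≡1+j) (ℕ.n<1+n (toℕ j)))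

  feasible : Linked ℕ._≤_ xs → 0 ℕ.< denominator → Feasible k a e (fromℕ f)
  feasible sorted 0<denominator = record
    { a-nonneg  = 0≤fromℕ ∘ lookup xs
    ; e-nonneg  = 0≤fromℕ ∘ lookup ds
    ; f-nonneg  = 0≤fromℕ f
    ; denom-pos = subst (0ℚ <_) (≡.sym f+Σ-sq-e) (fromℕ-mono-< 0<denominator)
    ; cond-i    = adjacent-sq-mono sorted
    ; cond-ii   = a≤a+e+e
    ; cond-iii  = suffixExcess≤worstSuffixExcess xs ds
    }

p-q<p : ∀ p {q} → 0ℚ < q → p - q < p
p-q<p p {q} 0<q = subst (p - q <_) (ℚ.+-identityʳ p) (ℚ.+-monoʳ-< p (ℚ.neg-antimono-< 0<q))

-- An increasing profile around the centre 10000, found numerically; its ratio is ≈ 2.8602.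
-- Abstract, so that only the three decisions below ever unfold it.
abstract
  profile : Vec ℕ 1000
  profile =
    6291 ∷ 6294 ∷ 6296 ∷ 6298 ∷ 6301 ∷ 6303 ∷ 6306 ∷ 6308 ∷ 6311 ∷ 6313 ∷
    6316 ∷ 6318 ∷ 6321 ∷ 6323 ∷ 6326 ∷ 6328 ∷ 6331 ∷ 6334 ∷ 6336 ∷ 6339 ∷
    6341 ∷ 6344 ∷ 6346 ∷ 6349 ∷ 6352 ∷ 6354 ∷ 6357 ∷ 6359 ∷ 6362 ∷ 6365 ∷
    6367 ∷ 6370 ∷ 6373 ∷ 6375 ∷ 6378 ∷ 6381 ∷ 6383 ∷ 6386 ∷ 6389 ∷ 6391 ∷
    6394 ∷ 6397 ∷ 6400 ∷ 6402 ∷ 6405 ∷ 6408 ∷ 6411 ∷ 6413 ∷ 6416 ∷ 6419 ∷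
    6422 ∷ 6424 ∷ 6427 ∷ 6430 ∷ 6433 ∷ 6436 ∷ 6439 ∷ 6441 ∷ 6444 ∷ 6447 ∷
    6450 ∷ 6453 ∷ 6456 ∷ 6459 ∷ 6461 ∷ 6464 ∷ 6467 ∷ 6470 ∷ 6473 ∷ 6476 ∷
    6479 ∷ 6482 ∷ 6485 ∷ 6488 ∷ 6491 ∷ 6494 ∷ 6497 ∷ 6500 ∷ 6503 ∷ 6506 ∷
    6509 ∷ 6512 ∷ 6515 ∷ 6518 ∷ 6521 ∷ 6524 ∷ 6527 ∷ 6530 ∷ 6533 ∷ 6536 ∷
    6540 ∷ 6543 ∷ 6546 ∷ 6549 ∷ 6552 ∷ 6555 ∷ 6558 ∷ 6562 ∷ 6565 ∷ 6568 ∷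
    6571 ∷ 6574 ∷ 6578 ∷ 6581 ∷ 6584 ∷ 6587 ∷ 6590 ∷ 6594 ∷ 6597 ∷ 6600 ∷
    6604 ∷ 6607 ∷ 6610 ∷ 6613 ∷ 6617 ∷ 6620 ∷ 6623 ∷ 6627 ∷ 6630 ∷ 6634 ∷
    6637 ∷ 6640 ∷ 6644 ∷ 6647 ∷ 6651 ∷ 6654 ∷ 6657 ∷ 6661 ∷ 6664 ∷ 6668 ∷
    6671 ∷ 6675 ∷ 6678 ∷ 6682 ∷ 6685 ∷ 6689 ∷ 6692 ∷ 6696 ∷ 6699 ∷ 6703 ∷
    6707 ∷ 6710 ∷ 6714 ∷ 6717 ∷ 6721 ∷ 6725 ∷ 6728 ∷ 6732 ∷ 6736 ∷ 6739 ∷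
    6743 ∷ 6747 ∷ 6750 ∷ 6754 ∷ 6758 ∷ 6762 ∷ 6765 ∷ 6769 ∷ 6773 ∷ 6777 ∷
    6780 ∷ 6784 ∷ 6788 ∷ 6792 ∷ 6796 ∷ 6800 ∷ 6803 ∷ 6807 ∷ 6811 ∷ 6815 ∷
    6819 ∷ 6823 ∷ 6827 ∷ 6831 ∷ 6835 ∷ 6839 ∷ 6843 ∷ 6847 ∷ 6851 ∷ 6855 ∷
    6859 ∷ 6863 ∷ 6867 ∷ 6871 ∷ 6875 ∷ 6879 ∷ 6883 ∷ 6887 ∷ 6891 ∷ 6895 ∷
    6899 ∷ 6904 ∷ 6908 ∷ 6912 ∷ 6916 ∷ 6920 ∷ 6925 ∷ 6929 ∷ 6933 ∷ 6937 ∷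
    6942 ∷ 6946 ∷ 6950 ∷ 6954 ∷ 6959 ∷ 6963 ∷ 6967 ∷ 6972 ∷ 6976 ∷ 6981 ∷
    6985 ∷ 6989 ∷ 6994 ∷ 6998 ∷ 7003 ∷ 7007 ∷ 7012 ∷ 7016 ∷ 7021 ∷ 7025 ∷
    7030 ∷ 7034 ∷ 7039 ∷ 7043 ∷ 7048 ∷ 7052 ∷ 7057 ∷ 7062 ∷ 7066 ∷ 7071 ∷
    7076 ∷ 7080 ∷ 7085 ∷ 7090 ∷ 7094 ∷ 7099 ∷ 7104 ∷ 7109 ∷ 7113 ∷ 7118 ∷
    7123 ∷ 7128 ∷ 7133 ∷ 7138 ∷ 7142 ∷ 7147 ∷ 7152 ∷ 7157 ∷ 7162 ∷ 7167 ∷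
    7172 ∷ 7177 ∷ 7182 ∷ 7187 ∷ 7192 ∷ 7197 ∷ 7202 ∷ 7207 ∷ 7212 ∷ 7217 ∷
    7222 ∷ 7228 ∷ 7233 ∷ 7238 ∷ 7243 ∷ 7248 ∷ 7254 ∷ 7259 ∷ 7264 ∷ 7269 ∷
    7275 ∷ 7280 ∷ 7285 ∷ 7290 ∷ 7296 ∷ 7301 ∷ 7307 ∷ 7312 ∷ 7317 ∷ 7323 ∷
    7328 ∷ 7334 ∷ 7339 ∷ 7345 ∷ 7350 ∷ 7356 ∷ 7361 ∷ 7367 ∷ 7372 ∷ 7378 ∷
    7384 ∷ 7389 ∷ 7395 ∷ 7401 ∷ 7406 ∷ 7412 ∷ 7418 ∷ 7423 ∷ 7429 ∷ 7435 ∷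
    7441 ∷ 7447 ∷ 7452 ∷ 7458 ∷ 7464 ∷ 7470 ∷ 7476 ∷ 7482 ∷ 7488 ∷ 7494 ∷
    7500 ∷ 7506 ∷ 7512 ∷ 7518 ∷ 7524 ∷ 7530 ∷ 7536 ∷ 7542 ∷ 7548 ∷ 7555 ∷
    7561 ∷ 7567 ∷ 7573 ∷ 7579 ∷ 7586 ∷ 7592 ∷ 7598 ∷ 7605 ∷ 7611 ∷ 7617 ∷
    7624 ∷ 7630 ∷ 7637 ∷ 7643 ∷ 7649 ∷ 7656 ∷ 7662 ∷ 7669 ∷ 7676 ∷ 7682 ∷
    7689 ∷ 7695 ∷ 7702 ∷ 7709 ∷ 7715 ∷ 7722 ∷ 7729 ∷ 7735 ∷ 7742 ∷ 7749 ∷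
    7756 ∷ 7763 ∷ 7770 ∷ 7776 ∷ 7783 ∷ 7790 ∷ 7797 ∷ 7804 ∷ 7811 ∷ 7818 ∷
    7825 ∷ 7832 ∷ 7839 ∷ 7847 ∷ 7854 ∷ 7861 ∷ 7868 ∷ 7875 ∷ 7882 ∷ 7890 ∷
    7897 ∷ 7904 ∷ 7912 ∷ 7919 ∷ 7926 ∷ 7934 ∷ 7941 ∷ 7949 ∷ 7956 ∷ 7964 ∷
    7971 ∷ 7979 ∷ 7986 ∷ 7994 ∷ 8001 ∷ 8009 ∷ 8017 ∷ 8025 ∷ 8032 ∷ 8040 ∷
    8048 ∷ 8056 ∷ 8063 ∷ 8071 ∷ 8079 ∷ 8087 ∷ 8095 ∷ 8103 ∷ 8111 ∷ 8119 ∷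
    8127 ∷ 8135 ∷ 8143 ∷ 8151 ∷ 8160 ∷ 8168 ∷ 8176 ∷ 8184 ∷ 8193 ∷ 8201 ∷
    8209 ∷ 8218 ∷ 8226 ∷ 8234 ∷ 8243 ∷ 8251 ∷ 8260 ∷ 8268 ∷ 8277 ∷ 8285 ∷
    8294 ∷ 8303 ∷ 8311 ∷ 8320 ∷ 8329 ∷ 8338 ∷ 8346 ∷ 8355 ∷ 8364 ∷ 8373 ∷
    8382 ∷ 8391 ∷ 8400 ∷ 8409 ∷ 8418 ∷ 8427 ∷ 8436 ∷ 8445 ∷ 8455 ∷ 8464 ∷
    8473 ∷ 8482 ∷ 8492 ∷ 8501 ∷ 8510 ∷ 8520 ∷ 8529 ∷ 8539 ∷ 8548 ∷ 8558 ∷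
    8567 ∷ 8577 ∷ 8586 ∷ 8596 ∷ 8606 ∷ 8616 ∷ 8625 ∷ 8635 ∷ 8645 ∷ 8655 ∷
    8665 ∷ 8675 ∷ 8685 ∷ 8695 ∷ 8705 ∷ 8715 ∷ 8725 ∷ 8735 ∷ 8745 ∷ 8756 ∷
    8766 ∷ 8776 ∷ 8787 ∷ 8797 ∷ 8807 ∷ 8818 ∷ 8828 ∷ 8839 ∷ 8849 ∷ 8860 ∷
    8871 ∷ 8881 ∷ 8892 ∷ 8903 ∷ 8914 ∷ 8925 ∷ 8935 ∷ 8946 ∷ 8957 ∷ 8968 ∷
    8979 ∷ 8991 ∷ 9002 ∷ 9013 ∷ 9024 ∷ 9035 ∷ 9047 ∷ 9058 ∷ 9069 ∷ 9081 ∷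
    9092 ∷ 9104 ∷ 9115 ∷ 9127 ∷ 9138 ∷ 9150 ∷ 9162 ∷ 9173 ∷ 9185 ∷ 9197 ∷
    9209 ∷ 9221 ∷ 9233 ∷ 9245 ∷ 9257 ∷ 9269 ∷ 9281 ∷ 9293 ∷ 9306 ∷ 9318 ∷
    9330 ∷ 9343 ∷ 9355 ∷ 9368 ∷ 9380 ∷ 9393 ∷ 9405 ∷ 9418 ∷ 9431 ∷ 9443 ∷
    9456 ∷ 9469 ∷ 9482 ∷ 9495 ∷ 9508 ∷ 9521 ∷ 9534 ∷ 9547 ∷ 9560 ∷ 9574 ∷
    9587 ∷ 9600 ∷ 9614 ∷ 9627 ∷ 9641 ∷ 9654 ∷ 9668 ∷ 9681 ∷ 9695 ∷ 9709 ∷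
    9723 ∷ 9737 ∷ 9751 ∷ 9764 ∷ 9778 ∷ 9793 ∷ 9807 ∷ 9821 ∷ 9835 ∷ 9849 ∷
    9864 ∷ 9878 ∷ 9893 ∷ 9907 ∷ 9922 ∷ 9936 ∷ 9951 ∷ 9966 ∷ 9981 ∷ 9996 ∷
    10010 ∷ 10025 ∷ 10040 ∷ 10056 ∷ 10071 ∷ 10086 ∷ 10101 ∷ 10117 ∷ 10132 ∷ 10147 ∷
    10163 ∷ 10179 ∷ 10194 ∷ 10210 ∷ 10226 ∷ 10242 ∷ 10257 ∷ 10273 ∷ 10289 ∷ 10306 ∷
    10322 ∷ 10338 ∷ 10354 ∷ 10370 ∷ 10387 ∷ 10403 ∷ 10420 ∷ 10437 ∷ 10453 ∷ 10470 ∷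
    10487 ∷ 10504 ∷ 10521 ∷ 10538 ∷ 10555 ∷ 10572 ∷ 10589 ∷ 10606 ∷ 10624 ∷ 10641 ∷
    10659 ∷ 10676 ∷ 10694 ∷ 10712 ∷ 10730 ∷ 10747 ∷ 10765 ∷ 10783 ∷ 10801 ∷ 10820 ∷
    10838 ∷ 10856 ∷ 10875 ∷ 10893 ∷ 10912 ∷ 10930 ∷ 10949 ∷ 10968 ∷ 10987 ∷ 11006 ∷
    11025 ∷ 11044 ∷ 11063 ∷ 11082 ∷ 11097 ∷ 11112 ∷ 11127 ∷ 11142 ∷ 11158 ∷ 11173 ∷
    11188 ∷ 11204 ∷ 11219 ∷ 11235 ∷ 11250 ∷ 11266 ∷ 11282 ∷ 11297 ∷ 11313 ∷ 11329 ∷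
    11345 ∷ 11361 ∷ 11377 ∷ 11393 ∷ 11409 ∷ 11426 ∷ 11442 ∷ 11458 ∷ 11475 ∷ 11491 ∷
    11508 ∷ 11525 ∷ 11541 ∷ 11558 ∷ 11575 ∷ 11592 ∷ 11609 ∷ 11626 ∷ 11643 ∷ 11661 ∷
    11678 ∷ 11695 ∷ 11713 ∷ 11730 ∷ 11748 ∷ 11765 ∷ 11783 ∷ 11801 ∷ 11819 ∷ 11837 ∷
    11855 ∷ 11873 ∷ 11891 ∷ 11909 ∷ 11928 ∷ 11946 ∷ 11965 ∷ 11983 ∷ 12002 ∷ 12021 ∷
    12039 ∷ 12058 ∷ 12077 ∷ 12096 ∷ 12116 ∷ 12135 ∷ 12154 ∷ 12174 ∷ 12193 ∷ 12213 ∷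
    12232 ∷ 12252 ∷ 12272 ∷ 12292 ∷ 12312 ∷ 12332 ∷ 12352 ∷ 12373 ∷ 12393 ∷ 12413 ∷
    12434 ∷ 12455 ∷ 12475 ∷ 12496 ∷ 12517 ∷ 12538 ∷ 12559 ∷ 12581 ∷ 12602 ∷ 12623 ∷
    12645 ∷ 12667 ∷ 12688 ∷ 12710 ∷ 12732 ∷ 12754 ∷ 12776 ∷ 12799 ∷ 12821 ∷ 12844 ∷
    12866 ∷ 12889 ∷ 12912 ∷ 12935 ∷ 12958 ∷ 12981 ∷ 13004 ∷ 13028 ∷ 13051 ∷ 13075 ∷
    13098 ∷ 13122 ∷ 13146 ∷ 13170 ∷ 13195 ∷ 13219 ∷ 13243 ∷ 13268 ∷ 13293 ∷ 13317 ∷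
    13342 ∷ 13367 ∷ 13393 ∷ 13418 ∷ 13443 ∷ 13469 ∷ 13495 ∷ 13521 ∷ 13547 ∷ 13573 ∷
    13599 ∷ 13626 ∷ 13652 ∷ 13679 ∷ 13706 ∷ 13733 ∷ 13760 ∷ 13787 ∷ 13815 ∷ 13842 ∷
    13870 ∷ 13898 ∷ 13926 ∷ 13954 ∷ 13983 ∷ 14011 ∷ 14040 ∷ 14069 ∷ 14098 ∷ 14127 ∷
    14156 ∷ 14186 ∷ 14215 ∷ 14245 ∷ 14275 ∷ 14305 ∷ 14336 ∷ 14366 ∷ 14397 ∷ 14428 ∷
    14459 ∷ 14490 ∷ 14522 ∷ 14553 ∷ 14585 ∷ 14617 ∷ 14649 ∷ 14682 ∷ 14714 ∷ 14747 ∷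
    14780 ∷ 14813 ∷ 14847 ∷ 14880 ∷ 14914 ∷ 14948 ∷ 14983 ∷ 15017 ∷ 15052 ∷ 15087 ∷
    15122 ∷ 15157 ∷ 15193 ∷ 15229 ∷ 15265 ∷ 15301 ∷ 15338 ∷ 15374 ∷ 15411 ∷ 15449 ∷
    15486 ∷ 15524 ∷ 15562 ∷ 15600 ∷ 15639 ∷ 15678 ∷ 15717 ∷ 15756 ∷ 15796 ∷ 15836 ∷
    15876 ∷ 15917 ∷ 15957 ∷ 15998 ∷ 16040 ∷ 16081 ∷ 16123 ∷ 16166 ∷ 16208 ∷ 16251 ∷
    16294 ∷ 16338 ∷ 16382 ∷ 16426 ∷ 16470 ∷ 16515 ∷ 16560 ∷ 16606 ∷ 16652 ∷ 16698 ∷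
    16745 ∷ 16792 ∷ 16839 ∷ 16887 ∷ 16935 ∷ 16984 ∷ 17033 ∷ 17082 ∷ 17132 ∷ 17182 ∷
    17232 ∷ 17283 ∷ 17335 ∷ 17387 ∷ 17439 ∷ 17492 ∷ 17545 ∷ 17599 ∷ 17653 ∷ 17707 ∷
    17762 ∷ 17818 ∷ 17874 ∷ 17931 ∷ 17988 ∷ 18046 ∷ 18104 ∷ 18163 ∷ 18222 ∷ 18282 ∷
    18342 ∷ 18403 ∷ 18465 ∷ 18527 ∷ 18590 ∷ 18653 ∷ 18717 ∷ 18782 ∷ 18848 ∷ 18914 ∷
    18980 ∷ 19048 ∷ 19116 ∷ 19185 ∷ 19254 ∷ 19325 ∷ 19396 ∷ 19468 ∷ 19541 ∷ 19614 ∷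
    19688 ∷ 19764 ∷ 19840 ∷ 19917 ∷ 19995 ∷ 20073 ∷ 20153 ∷ 20234 ∷ 20315 ∷ 20398 ∷
    20482 ∷ 20566 ∷ 20652 ∷ 20739 ∷ 20827 ∷ 20916 ∷ 21006 ∷ []
    ++ replicate 83 21082

  open CentredConfiguration 10000 profile public

  profile-sorted : Linked ℕ._≤_ profile
  profile-sorted = toWitness {a? = linked? ℕ._≤?_ profile} _

  0<denominator : 0 ℕ.< denominator
  0<denominator = toWitness {a? = 0 ℕ.<? denominator} _

  c286*denominator≤numerator : c286 * fromℕ denominator ≤ fromℕ numerator
  c286*denominator≤numerator = toWitness {a? = c286 * fromℕ denominator ℚ.≤? fromℕ numerator} _

lemma6 : (ε : ℚ) → 0ℚ < ε →
    Σ[ m ∈ ℕ ] Σ[ a ∈ (Fin (suc m) → ℚ) ] Σ[ e ∈ (Fin (suc m) → ℚ) ] Σ[ f ∈ ℚ ]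
      (Feasible (suc m) a e f ×
       (c286 - ε) * (f + Σ (λ j → sq (e j))) < Σ (λ j → sq (a j)))
lemma6 ε 0<ε = 999 , a , e , fromℕ f , feasible profile-sorted 0<denominator ,
  subst₂ (λ D N → (c286 - ε) * D < N) (≡.sym f+Σ-sq-e) (≡.sym Σ-sq-a)
    (ℚ.<-≤-trans (ℚ.*-monoˡ-<-pos (fromℕ denominator) {{positive (fromℕ-mono-< 0<denominator)}}
                                  (p-q<p c286 0<ε))
                 c286*denominator≤numerator)
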